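{- (1) The class $\mathcal{A}uto$ is closed under the sum (disjoint union) and under the Cartesian, lexicographic and categorical products: if $G_1, G_2 \in \mathcal{A}uto$, then $G_1+G_2$, $G_1\times G_2$, $G_1[G_2]$ and $G_1\cdot G_2$ all belong to $\mathcal{A}uto$. (2) Moreover, $\mathcal{A}uto$ is an ideal with respect to the categorical product: if $G\in\mathcal{A}uto$ and $H$ is an arbitrary graph, then both $G\cdot H$ and $H\cdot G$ belong to $\mathcal{A}uto$.
   Context: All graphs are finite simple graphs. An automorphism $\phi$ of a graph $G$ induces a permutation $\phi'$ of $E(G)$ by $\phi'(\{u,v\})=\{\phi(u),\phi(v)\}$; $\phi$ is involutory if it has order 2. $\mathcal{A}uto$ denotes the class of all graphs $G$ having an involutory automorphism $\phi$ such that $\phi'$ fixes no edge. For graphs $G_1,G_2$ with disjoint vertex sets, the sum $G_1+G_2$ has vertex set $V(G_1)\cup V(G_2)$ and edge set $E(G_1)\cup E(G_2)$. The three products have vertex set $V(G_1)\times V(G_2)$, and $(u_1,u_2)$, $(v_1,v_2)$ are adjacent: in the Cartesian product $G_1\times G_2$ iff either $u_1=v_1$ and $\{u_2,v_2\}\in E(G_2)$, or $u_2=v_2$ and $\{u_1,v_1\}\in E(G_1)$; in the lexicographic product $G_1[G_2]$ iff either $\{u_1,v_1\}\in E(G_1)$, or $u_1=v_1$ and $\{u_2,v_2\}\in E(G_2)$; in the categorical product $G_1\cdot G_2$ iff $\{u_1,v_1\}\in E(G_1)$ and $\{u_2,v_2\}\in E(G_2)$. -}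

module Defs where

open import Data.Nat using (ℕ; _+_; _*_; NonZero)
open import Data.Fin using (Fin; splitAt; remQuot)
open import Data.Bool using (Bool; true; false; _∧_; _∨_)
open import Data.Sum using (_⊎_; inj₁; inj₂)
open import Data.Product using (_×_; _,_; Σ; ∃)
open import Relation.Binary.PropositionalEquality using (_≡_)
open import Relation.Nullary using (¬_)
open import Data.Fin.Properties using (_≟_)
open import Relation.Nullary.Decidable using (⌊_⌋)

record Graph : Set where
  constructor mkGraph
  field
    n     : ℕ
    adj   : Fin n → Fin n → Bool

open Graph public

IsSimple : Graph → Set
-- (Graphs have a nonempty vertex set, the standard convention.)
IsSimple G = NonZero (n G) × (∀ u v → adj G u v ≡ adj G v u) × (∀ u → adj G u u ≡ false)

Edge : (G : Graph) → Fin (n G) → Fin (n G) → Set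
Edge G u v = adj G u v ≡ true

record Automorphism (G : Graph) : Set where
  field
    φ      : Fin (n G) → Fin (n G)
    φ⁻¹    : Fin (n G) → Fin (n G)
    left   : ∀ v → φ⁻¹ (φ v) ≡ v
    right  : ∀ v → φ (φ⁻¹ v) ≡ v
    pres   : ∀ u v → adj G (φ u) (φ v) ≡ adj G u v

open Automorphism public

Involutory : {G : Graph} → Automorphism G → Set
Involutory {G} f = (∀ v → φ f (φ f v) ≡ v) × ¬ (∀ v → φ f v ≡ v)

-- The induced edge permutation φ' fixes the edge {u,v}:
-- {φ u, φ v} = {u, v} as unordered pairs.
FixesEdge : {G : Graph} → Automorphism G → Fin (n G) → Fin (n G) → Set
FixesEdge f u v = (φ f u ≡ u × φ f v ≡ v) ⊎ (φ f u ≡ v × φ f v ≡ u)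

InAuto : Graph → Set
InAuto G = Σ (Automorphism G) λ f →
  Involutory f × (∀ u v → Edge G u v → ¬ FixesEdge f u v)

_==_ : ∀ {k} → Fin k → Fin k → Bool
a == b = ⌊ a ≟ b ⌋

sumAdj : (G₁ G₂ : Graph) → Fin (n G₁ + n G₂) → Fin (n G₁ + n G₂) → Bool
sumAdj G₁ G₂ x y with splitAt (n G₁) x | splitAt (n G₁) y
... | inj₁ a | inj₁ b = adj G₁ a b
... | inj₂ a | inj₂ b = adj G₂ a b
... | inj₁ _ | inj₂ _ = false
... | inj₂ _ | inj₁ _ = false

cartAdj lexAdj catAdj : (G₁ G₂ : Graph) → Fin (n G₁ * n G₂) → Fin (n G₁ * n G₂) → Bool
cartAdj G₁ G₂ x y with remQuot (n G₂) x | remQuot (n G₂) y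
... | (u₁ , u₂) | (v₁ , v₂) = ((u₁ == v₁) ∧ adj G₂ u₂ v₂) ∨ ((u₂ == v₂) ∧ adj G₁ u₁ v₁)
lexAdj G₁ G₂ x y with remQuot (n G₂) x | remQuot (n G₂) y
... | (u₁ , u₂) | (v₁ , v₂) = adj G₁ u₁ v₁ ∨ ((u₁ == v₁) ∧ adj G₂ u₂ v₂)
catAdj G₁ G₂ x y with remQuot (n G₂) x | remQuot (n G₂) y
... | (u₁ , u₂) | (v₁ , v₂) = adj G₁ u₁ v₁ ∧ adj G₂ u₂ v₂

_+ᴳ_ _×ᴳ_ _·ᴳ_ : Graph → Graph → Graph
G₁ +ᴳ G₂ = mkGraph (n G₁ + n G₂) (sumAdj G₁ G₂)
G₁ ×ᴳ G₂ = mkGraph (n G₁ * n G₂) (cartAdj G₁ G₂)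
G₁ ·ᴳ G₂ = mkGraph (n G₁ * n G₂) (catAdj G₁ G₂)

_[_]ᴳ : Graph → Graph → Graph
G₁ [ G₂ ]ᴳ = mkGraph (n G₁ * n G₂) (lexAdj G₁ G₂)

-- Each class member G comes with an involution σ of its vertices that preserves adjacency
-- and moves every edge. On a sum, σ₁ ⊎ σ₂ works; on the three products, σ₁ × σ₂ works,
-- because every product edge projects onto an edge of a factor, and a product edge fixed
-- by σ₁ × σ₂ would project onto a factor edge fixed by σ₁ or σ₂. For the categorical
-- product every edge projects onto an edge of both factors, so the other factor may carry
-- the identity, which gives the ideal property.
module Submission where

open import Defs
open import Data.Bool using (Bool; true; false; _∧_; _∨_)
open import Data.Empty using (⊥-elim)
open import Data.Fin using (Fin; zero; splitAt; remQuot)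
open import Data.Fin.Properties using (_≟_; +↔⊎; *↔×)
open import Data.Nat using (suc; NonZero)
open import Data.Product using (_×_; _,_; proj₁; proj₂; map)
open import Data.Sum using (_⊎_; inj₁; inj₂)
open import Data.Sum.Properties using (inj₁-injective; inj₂-injective)
open import Function using (_↔_; Inverse; mk⇔; _∘′_)
open import Relation.Binary.Definitions using (DecidableEquality)
open import Relation.Binary.PropositionalEquality
open import Relation.Nullary using (¬_)
open import Relation.Nullary.Decidable using (⌊_⌋; does-⇔; isYes≗does)

BoolRel : Set → Set
BoolRel V = V → V → Bool

module _ {A : Set} where

  Involutive : (A → A) → Set
  Involutive f = ∀ x → f (f x) ≡ x

  Nontrivial : (A → A) → Set
  Nontrivial f = ¬ (∀ x → f x ≡ x)

  FixesPair : (A → A) → A → A → Set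
  FixesPair f u v = (f u ≡ u × f v ≡ v) ⊎ (f u ≡ v × f v ≡ u)

  EdgeFree : BoolRel A → (A → A) → Set
  EdgeFree R f = ∀ u v → R u v ≡ true → ¬ FixesPair f u v

  involutive⇒injective : ∀ {f} → Involutive f → ∀ {x y} → f x ≡ f y → x ≡ y
  involutive⇒injective {f} inv {x} {y} fx≡fy = trans (sym (inv x)) (trans (cong f fx≡fy) (inv y))

  ⌊≟⌋-involutive : (_≟ᴬ_ : DecidableEquality A) {f : A → A} → Involutive f →
                   ∀ x y → ⌊ f x ≟ᴬ f y ⌋ ≡ ⌊ x ≟ᴬ y ⌋
  ⌊≟⌋-involutive _≟ᴬ_ {f} inv x y = begin
    ⌊ f x ≟ᴬ f y ⌋     ≡⟨ isYes≗does (f x ≟ᴬ f y) ⟩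
    _                  ≡⟨ does-⇔ (mk⇔ (involutive⇒injective inv) (cong f)) (f x ≟ᴬ f y) (x ≟ᴬ y) ⟩
    _                  ≡⟨ isYes≗does (x ≟ᴬ y) ⟨
    ⌊ x ≟ᴬ y ⌋         ∎
    where open ≡-Reasoning

module _ {A B : Set} {f : A → A} {g : B → B} where

  FixesPair-image : (h : A → B) → (∀ x → h (f x) ≡ g (h x)) →
                    ∀ {u v} → FixesPair f u v → FixesPair g (h u) (h v)
  FixesPair-image h comm {u} {v} (inj₁ (fu≡u , fv≡v)) =
    inj₁ (trans (sym (comm u)) (cong h fu≡u) , trans (sym (comm v)) (cong h fv≡v))
  FixesPair-image h comm {u} {v} (inj₂ (fu≡v , fv≡u)) =
    inj₂ (trans (sym (comm u)) (cong h fu≡v) , trans (sym (comm v)) (cong h fv≡u))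

  FixesPair-preimage : (h : A → B) → (∀ {x y} → h x ≡ h y → x ≡ y) → (∀ x → h (f x) ≡ g (h x)) →
                       ∀ {u v} → FixesPair g (h u) (h v) → FixesPair f u v
  FixesPair-preimage h inj comm {u} {v} (inj₁ (gu≡u , gv≡v)) =
    inj₁ (inj (trans (comm u) gu≡u) , inj (trans (comm v) gv≡v))
  FixesPair-preimage h inj comm {u} {v} (inj₂ (gu≡v , gv≡u)) =
    inj₂ (inj (trans (comm u) gu≡v) , inj (trans (comm v) gv≡u))

record Symmetry {V : Set} (R : BoolRel V) : Set where
  field
    σ          : V → V
    involutive : Involutive σ
    preserves  : ∀ u v → R (σ u) (σ v) ≡ R u v

record EdgeFreeInvolution {V : Set} (R : BoolRel V) : Set where
  field
    symmetry   : Symmetry R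
  open Symmetry symmetry public
  field
    nontrivial : Nontrivial σ
    edgeFree   : EdgeFree R σ

open EdgeFreeInvolution

identitySymmetry : ∀ {V} {R : BoolRel V} → Symmetry R
identitySymmetry = record { σ = λ v → v ; involutive = λ _ → refl ; preserves = λ _ _ → refl }

EdgeFreeInvolution⇒InAuto : ∀ G → EdgeFreeInvolution (adj G) → InAuto G
EdgeFreeInvolution⇒InAuto G e = automorphism , (involutive e , nontrivial e) , edgeFree e
  where
  automorphism : Automorphism G
  automorphism = record
    { φ = σ e ; φ⁻¹ = σ e ; left = involutive e ; right = involutive e ; pres = preserves e }

InAuto⇒EdgeFreeInvolution : ∀ {G} → InAuto G → EdgeFreeInvolution (adj G)
InAuto⇒EdgeFreeInvolution (f , (involutive , nontrivial) , edgeFree) = record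
  { symmetry   = record { σ = φ f ; involutive = involutive ; preserves = pres f }
  ; nontrivial = nontrivial
  ; edgeFree   = edgeFree
  }

module _ {A V : Set} (iso : A ↔ V) where
  open Inverse iso using (to; from; strictlyInverseˡ; strictlyInverseʳ)

  conjugate : ∀ {R : BoolRel A} {S : BoolRel V} → (∀ x y → R x y ≡ S (to x) (to y)) →
              EdgeFreeInvolution S → EdgeFreeInvolution R
  conjugate {R} {S} R≡S e = record
    { symmetry   = record { σ = σ′ ; involutive = involutive′ ; preserves = preserves′ }
    ; nontrivial = λ σ′-id → nontrivial e (λ v → begin
        σ e v                ≡⟨ cong (σ e) (strictlyInverseˡ v) ⟨
        σ e (to (from v))    ≡⟨ to-σ′ (from v) ⟨
        to (σ′ (from v))     ≡⟨ cong to (σ′-id (from v)) ⟩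
        to (from v)          ≡⟨ strictlyInverseˡ v ⟩
        v                    ∎)
    ; edgeFree   = λ u v uv fix → edgeFree e (to u) (to v) (trans (sym (R≡S u v)) uv)
                                    (FixesPair-image {g = σ e} to to-σ′ fix)
    }
    where
    open ≡-Reasoning
    σ′ : A → A
    σ′ x = from (σ e (to x))

    to-σ′ : ∀ x → to (σ′ x) ≡ σ e (to x)
    to-σ′ x = strictlyInverseˡ (σ e (to x))

    involutive′ : Involutive σ′
    involutive′ x = begin
      from (σ e (to (σ′ x)))  ≡⟨ cong (from ∘′ σ e) (to-σ′ x) ⟩
      from (σ e (σ e (to x))) ≡⟨ cong from (involutive e (to x)) ⟩
      from (to x)             ≡⟨ strictlyInverseʳ x ⟩
      x                       ∎

    preserves′ : ∀ u v → R (σ′ u) (σ′ v) ≡ R u v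
    preserves′ u v = begin
      R (σ′ u) (σ′ v)                 ≡⟨ R≡S (σ′ u) (σ′ v) ⟩
      S (to (σ′ u)) (to (σ′ v))       ≡⟨ cong₂ S (to-σ′ u) (to-σ′ v) ⟩
      S (σ e (to u)) (σ e (to v))     ≡⟨ preserves e (to u) (to v) ⟩
      S (to u) (to v)                 ≡⟨ R≡S u v ⟨
      R u v                           ∎

∨-true : ∀ x {y} → x ∨ y ≡ true → x ≡ true ⊎ y ≡ true
∨-true true  _  = inj₁ refl
∨-true false xy = inj₂ xy

∧-trueˡ : ∀ x {y} → x ∧ y ≡ true → x ≡ true
∧-trueˡ true  _  = refl
∧-trueˡ false ()

∧-trueʳ : ∀ x {y} → x ∧ y ≡ true → y ≡ true
∧-trueʳ true  xy = xy
∧-trueʳ false ()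

module _ {A B : Set} where

  sumRel : BoolRel A → BoolRel B → BoolRel (A ⊎ B)
  sumRel R S (inj₁ u) (inj₁ v) = R u v
  sumRel R S (inj₂ u) (inj₂ v) = S u v
  sumRel R S (inj₁ _) (inj₂ _) = false
  sumRel R S (inj₂ _) (inj₁ _) = false

  cartRel : DecidableEquality A → DecidableEquality B → BoolRel A → BoolRel B → BoolRel (A × B)
  cartRel _≟ᴬ_ _≟ᴮ_ R S (u₁ , u₂) (v₁ , v₂) = (⌊ u₁ ≟ᴬ v₁ ⌋ ∧ S u₂ v₂) ∨ (⌊ u₂ ≟ᴮ v₂ ⌋ ∧ R u₁ v₁)

  lexRel : DecidableEquality A → BoolRel A → BoolRel B → BoolRel (A × B)
  lexRel _≟ᴬ_ R S (u₁ , u₂) (v₁ , v₂) = R u₁ v₁ ∨ (⌊ u₁ ≟ᴬ v₁ ⌋ ∧ S u₂ v₂)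

  catRel : BoolRel A → BoolRel B → BoolRel (A × B)
  catRel R S (u₁ , u₂) (v₁ , v₂) = R u₁ v₁ ∧ S u₂ v₂

module _ {A B : Set} {f : A → A} {g : B → B} where

  ×-involutive : Involutive f → Involutive g → Involutive (map f g)
  ×-involutive inv₁ inv₂ (a , b) = cong₂ _,_ (inv₁ a) (inv₂ b)

  -- No element of B is needed: for each b, nontriviality of f yields a contradiction,
  -- so g is vacuously the identity.
  ×-nontrivial : Nontrivial f → Nontrivial g → Nontrivial (map f g)
  ×-nontrivial nt₁ nt₂ all = nt₂ λ b → ⊥-elim (nt₁ λ a → cong proj₁ (all (a , b)))

  ×-nontrivialˡ : Nontrivial f → B → Nontrivial (map f g)
  ×-nontrivialˡ nt₁ b all = nt₁ λ a → cong proj₁ (all (a , b))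

  ×-nontrivialʳ : A → Nontrivial g → Nontrivial (map f g)
  ×-nontrivialʳ a nt₂ all = nt₂ λ b → cong proj₂ (all (a , b))

  FixesPair-proj₁ : ∀ {p q} → FixesPair (map f g) p q → FixesPair f (proj₁ p) (proj₁ q)
  FixesPair-proj₁ = FixesPair-image proj₁ (λ _ → refl)

  FixesPair-proj₂ : ∀ {p q} → FixesPair (map f g) p q → FixesPair g (proj₂ p) (proj₂ q)
  FixesPair-proj₂ = FixesPair-image proj₂ (λ _ → refl)

module _ {A B : Set} {R : BoolRel A} {S : BoolRel B} where

  sumEdgeFreeInvolution : EdgeFreeInvolution R → EdgeFreeInvolution S →
                          EdgeFreeInvolution (sumRel R S)
  sumEdgeFreeInvolution e₁ e₂ = record
    { symmetry   = record { σ = σ⊎ ; involutive = involutive⊎ ; preserves = preserves⊎ }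
    ; nontrivial = λ all → nontrivial e₁ λ a → inj₁-injective (all (inj₁ a))
    ; edgeFree   = edgeFree⊎
    }
    where
    σ⊎ : A ⊎ B → A ⊎ B
    σ⊎ (inj₁ a) = inj₁ (σ e₁ a)
    σ⊎ (inj₂ b) = inj₂ (σ e₂ b)

    involutive⊎ : Involutive σ⊎
    involutive⊎ (inj₁ a) = cong inj₁ (involutive e₁ a)
    involutive⊎ (inj₂ b) = cong inj₂ (involutive e₂ b)

    preserves⊎ : ∀ p q → sumRel R S (σ⊎ p) (σ⊎ q) ≡ sumRel R S p q
    preserves⊎ (inj₁ a) (inj₁ b) = preserves e₁ a b
    preserves⊎ (inj₂ a) (inj₂ b) = preserves e₂ a b
    preserves⊎ (inj₁ _) (inj₂ _) = refl
    preserves⊎ (inj₂ _) (inj₁ _) = refl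

    edgeFree⊎ : EdgeFree (sumRel R S) σ⊎
    edgeFree⊎ (inj₁ a) (inj₁ b) ab fix =
      edgeFree e₁ a b ab (FixesPair-preimage {g = σ⊎} inj₁ inj₁-injective (λ _ → refl) fix)
    edgeFree⊎ (inj₂ a) (inj₂ b) ab fix =
      edgeFree e₂ a b ab (FixesPair-preimage {g = σ⊎} inj₂ inj₂-injective (λ _ → refl) fix)
    edgeFree⊎ (inj₁ _) (inj₂ _) ()
    edgeFree⊎ (inj₂ _) (inj₁ _) ()

  module _ (_≟ᴬ_ : DecidableEquality A) (_≟ᴮ_ : DecidableEquality B) where

    cartEdgeFreeInvolution : EdgeFreeInvolution R → EdgeFreeInvolution S →
                             EdgeFreeInvolution (cartRel _≟ᴬ_ _≟ᴮ_ R S)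
    cartEdgeFreeInvolution e₁ e₂ = record
      { symmetry   = record
        { σ          = map (σ e₁) (σ e₂)
        ; involutive = ×-involutive {f = σ e₁} {g = σ e₂} (involutive e₁) (involutive e₂)
        ; preserves  = λ (u₁ , u₂) (v₁ , v₂) →
            cong₂ _∨_ (cong₂ _∧_ (⌊≟⌋-involutive _≟ᴬ_ (involutive e₁) u₁ v₁) (preserves e₂ u₂ v₂))
                      (cong₂ _∧_ (⌊≟⌋-involutive _≟ᴮ_ (involutive e₂) u₂ v₂) (preserves e₁ u₁ v₁))
        }
      ; nontrivial = ×-nontrivial (nontrivial e₁) (nontrivial e₂)
      ; edgeFree   = edgeFree×
      }
      where
      edgeFree× : EdgeFree (cartRel _≟ᴬ_ _≟ᴮ_ R S) (map (σ e₁) (σ e₂))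
      edgeFree× (u₁ , u₂) (v₁ , v₂) uv fix with ∨-true (⌊ u₁ ≟ᴬ v₁ ⌋ ∧ S u₂ v₂) uv
      ... | inj₁ same₁ = edgeFree e₂ u₂ v₂ (∧-trueʳ ⌊ u₁ ≟ᴬ v₁ ⌋ same₁) (FixesPair-proj₂ fix)
      ... | inj₂ same₂ = edgeFree e₁ u₁ v₁ (∧-trueʳ ⌊ u₂ ≟ᴮ v₂ ⌋ same₂) (FixesPair-proj₁ fix)

  module _ (_≟ᴬ_ : DecidableEquality A) where

    lexEdgeFreeInvolution : EdgeFreeInvolution R → EdgeFreeInvolution S →
                            EdgeFreeInvolution (lexRel _≟ᴬ_ R S)
    lexEdgeFreeInvolution e₁ e₂ = record
      { symmetry   = record
        { σ          = map (σ e₁) (σ e₂)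
        ; involutive = ×-involutive {f = σ e₁} {g = σ e₂} (involutive e₁) (involutive e₂)
        ; preserves  = λ (u₁ , u₂) (v₁ , v₂) →
            cong₂ _∨_ (preserves e₁ u₁ v₁)
                      (cong₂ _∧_ (⌊≟⌋-involutive _≟ᴬ_ (involutive e₁) u₁ v₁) (preserves e₂ u₂ v₂))
        }
      ; nontrivial = ×-nontrivial (nontrivial e₁) (nontrivial e₂)
      ; edgeFree   = edgeFree×
      }
      where
      edgeFree× : EdgeFree (lexRel _≟ᴬ_ R S) (map (σ e₁) (σ e₂))
      edgeFree× (u₁ , u₂) (v₁ , v₂) uv fix with ∨-true (R u₁ v₁) uv
      ... | inj₁ edge₁ = edgeFree e₁ u₁ v₁ edge₁ (FixesPair-proj₁ fix)
      ... | inj₂ same₁ = edgeFree e₂ u₂ v₂ (∧-trueʳ ⌊ u₁ ≟ᴬ v₁ ⌋ same₁) (FixesPair-proj₂ fix)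

  catEdgeFreeInvolution : (s₁ : Symmetry R) (s₂ : Symmetry S) →
                          let σ₁ = Symmetry.σ s₁; σ₂ = Symmetry.σ s₂ in
                          Nontrivial (map σ₁ σ₂) → EdgeFree R σ₁ ⊎ EdgeFree S σ₂ →
                          EdgeFreeInvolution (catRel R S)
  catEdgeFreeInvolution s₁ s₂ nt free = record
    { symmetry   = record
      { σ          = map (Symmetry.σ s₁) (Symmetry.σ s₂)
      ; involutive = ×-involutive {f = Symmetry.σ s₁} {g = Symmetry.σ s₂}
                       (Symmetry.involutive s₁) (Symmetry.involutive s₂)
      ; preserves  = λ (u₁ , u₂) (v₁ , v₂) →
          cong₂ _∧_ (Symmetry.preserves s₁ u₁ v₁) (Symmetry.preserves s₂ u₂ v₂)
      }
    ; nontrivial = nt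
    ; edgeFree   = edgeFree× free
    }
    where
    edgeFree× : EdgeFree R (Symmetry.σ s₁) ⊎ EdgeFree S (Symmetry.σ s₂) →
                EdgeFree (catRel R S) (map (Symmetry.σ s₁) (Symmetry.σ s₂))
    edgeFree× (inj₁ free₁) (u₁ , _) (v₁ , _) uv fix =
      free₁ u₁ v₁ (∧-trueˡ (R u₁ v₁) uv) (FixesPair-proj₁ fix)
    edgeFree× (inj₂ free₂) (u₁ , u₂) (v₁ , v₂) uv fix =
      free₂ u₂ v₂ (∧-trueʳ (R u₁ v₁) uv) (FixesPair-proj₂ fix)

-- The sum and products live on Fin (n₁ + n₂) and Fin (n₁ * n₂); they are analysed on
-- Fin n₁ ⊎ Fin n₂ and Fin n₁ × Fin n₂ and transported back along +↔⊎ and *↔×.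
InAuto-conjugate : ∀ G {V} {R : BoolRel V} (iso : Fin (n G) ↔ V) →
                   (∀ x y → adj G x y ≡ R (Inverse.to iso x) (Inverse.to iso y)) →
                   EdgeFreeInvolution R → InAuto G
InAuto-conjugate G iso adj≡R e = EdgeFreeInvolution⇒InAuto G (conjugate iso adj≡R e)

module _ (G₁ G₂ : Graph) where

  sumAdj≡sumRel : ∀ x y → sumAdj G₁ G₂ x y ≡
                          sumRel (adj G₁) (adj G₂) (splitAt (n G₁) x) (splitAt (n G₁) y)
  sumAdj≡sumRel x y with splitAt (n G₁) x | splitAt (n G₁) y
  ... | inj₁ _ | inj₁ _ = refl
  ... | inj₂ _ | inj₂ _ = refl
  ... | inj₁ _ | inj₂ _ = refl
  ... | inj₂ _ | inj₁ _ = refl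

  cartAdj≡cartRel : ∀ x y → cartAdj G₁ G₂ x y ≡
                            cartRel _≟_ _≟_ (adj G₁) (adj G₂) (remQuot (n G₂) x) (remQuot (n G₂) y)
  cartAdj≡cartRel x y with remQuot {n G₁} (n G₂) x | remQuot {n G₁} (n G₂) y
  ... | _ , _ | _ , _ = refl

  lexAdj≡lexRel : ∀ x y → lexAdj G₁ G₂ x y ≡
                          lexRel _≟_ (adj G₁) (adj G₂) (remQuot (n G₂) x) (remQuot (n G₂) y)
  lexAdj≡lexRel x y with remQuot {n G₁} (n G₂) x | remQuot {n G₁} (n G₂) y
  ... | _ , _ | _ , _ = refl

  catAdj≡catRel : ∀ x y → catAdj G₁ G₂ x y ≡
                          catRel (adj G₁) (adj G₂) (remQuot (n G₂) x) (remQuot (n G₂) y)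
  catAdj≡catRel x y with remQuot {n G₁} (n G₂) x | remQuot {n G₁} (n G₂) y
  ... | _ , _ | _ , _ = refl

vertex : ∀ {k} → NonZero k → Fin k
vertex {suc _} _ = zero

theorem2 : (∀ G₁ G₂ → IsSimple G₁ → IsSimple G₂ → InAuto G₁ → InAuto G₂ →
             InAuto (G₁ +ᴳ G₂) × InAuto (G₁ ×ᴳ G₂) × InAuto (G₁ [ G₂ ]ᴳ) × InAuto (G₁ ·ᴳ G₂))
           × (∀ G H → IsSimple G → IsSimple H → InAuto G →
             InAuto (G ·ᴳ H) × InAuto (H ·ᴳ G))
theorem2 = closure , ideal
  where
  closure : ∀ G₁ G₂ → IsSimple G₁ → IsSimple G₂ → InAuto G₁ → InAuto G₂ →
            InAuto (G₁ +ᴳ G₂) × InAuto (G₁ ×ᴳ G₂) × InAuto (G₁ [ G₂ ]ᴳ) × InAuto (G₁ ·ᴳ G₂)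
  closure G₁ G₂ _ _ a₁ a₂ =
      InAuto-conjugate (G₁ +ᴳ G₂) +↔⊎ (sumAdj≡sumRel G₁ G₂) (sumEdgeFreeInvolution e₁ e₂)
    , InAuto-conjugate (G₁ ×ᴳ G₂) *↔× (cartAdj≡cartRel G₁ G₂) (cartEdgeFreeInvolution _≟_ _≟_ e₁ e₂)
    , InAuto-conjugate (G₁ [ G₂ ]ᴳ) *↔× (lexAdj≡lexRel G₁ G₂) (lexEdgeFreeInvolution _≟_ e₁ e₂)
    , InAuto-conjugate (G₁ ·ᴳ G₂) *↔× (catAdj≡catRel G₁ G₂)
        (catEdgeFreeInvolution (symmetry e₁) (symmetry e₂)
          (×-nontrivial (nontrivial e₁) (nontrivial e₂)) (inj₁ (edgeFree e₁)))
    where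
    e₁ = InAuto⇒EdgeFreeInvolution a₁
    e₂ = InAuto⇒EdgeFreeInvolution a₂

  ideal : ∀ G H → IsSimple G → IsSimple H → InAuto G → InAuto (G ·ᴳ H) × InAuto (H ·ᴳ G)
  ideal G H _ (nonempty , _) a =
      InAuto-conjugate (G ·ᴳ H) *↔× (catAdj≡catRel G H)
        (catEdgeFreeInvolution (symmetry e) (identitySymmetry {R = adj H})
          (×-nontrivialˡ (nontrivial e) (vertex nonempty)) (inj₁ (edgeFree e)))
    , InAuto-conjugate (H ·ᴳ G) *↔× (catAdj≡catRel H G)
        (catEdgeFreeInvolution (identitySymmetry {R = adj H}) (symmetry e)
          (×-nontrivialʳ (vertex nonempty) (nontrivial e)) (inj₂ (edgeFree e)))
    where
    e = InAuto⇒EdgeFreeInvolution a
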